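{- For every integer $n\ge 2$, $\rho(n)=n-2$. Moreover, there exist permutations of length $n$ and rev-tier $n-2$ for which $(1,2),(2,3),\ldots,(n-2,n-1)$ is a maximum length sequence of separated pairs with increasing smaller entries and alternating orientations beginning with a down separated pair.
   Context: Sorting procedure: a permutation $\pi$ is processed using an input sequence (initially $\pi_1,\ldots,\pi_n$), a stack and an output. Let $m$ be the smallest value not yet output. At each step: if the stack's top entry equals $m$, pop it to the output; otherwise, if the input is nonempty, push the next input entry onto the stack. When no move is possible and the stack is nonempty, the remaining stack entries are returned to the input in the reverse of their order in the previous input (i.e. listed from top of stack to bottom), and the procedure is repeated. The rev-tier $t_{\operatorname{rev}}(\pi)$ is the number of times entries must be returned to the input before the output is $1,2,\ldots,n$. $\rho(n)$ denotes the maximum rev-tier of a permutation of length $n$. For $\sigma\in S_n$, $(i,i+1)$ is a separated pair if some entry $k>i+1$ lies between $i$ and $i+1$ in $\sigma$; it is up separated if $i$ precedes $i+1$ and down separated otherwise. -}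

module Defs where

open import Data.Nat using (ℕ; zero; suc; _+_; _<_; _≤_; _≟_)
open import Data.List using (List; []; _∷_; _++_; upTo; map; length)
open import Data.List.Membership.Propositional using (_∈_)
open import Data.List.Relation.Unary.All using (All)
open import Data.List.Relation.Binary.Permutation.Propositional using (_↭_)
open import Data.Product using (_×_; _,_; proj₁; proj₂; Σ; ∃; ∃-syntax)
open import Data.Unit using (⊤)
open import Relation.Nullary using (¬_; yes; no)
open import Relation.Binary.PropositionalEquality using (_≡_)

-- A permutation of length n, in one-line notation, as a list of the values 1..n.
IsPerm : ℕ → List ℕ → Set
IsPerm n π = π ↭ map suc (upTo n)

-- Stacks are lists whose head is the top entry.
-- pop m s : repeatedly pop while the top equals m (the smallest value not yet
-- output); returns the new m and the remaining stack.
popAll : ℕ → List ℕ → ℕ × List ℕ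
popAll m [] = m , []
popAll m (x ∷ s) with x ≟ m
... | yes _ = popAll (suc m) s
... | no  _ = m , x ∷ s

-- One pass of the procedure: given m, the input and the stack, perform moves
-- (pop if top = m, otherwise push the next input entry) until no move is
-- possible; returns the final m and the final stack.
pass : ℕ → List ℕ → List ℕ → ℕ × List ℕ
pass m []      s = popAll m s
pass m (x ∷ i) s with popAll m s
... | m' , s' = pass m' i (x ∷ s')

-- Stuck with stack S: the remaining entries are returned to the input, listed
-- from top of the stack to bottom (i.e. the stack list itself).
-- A state is (m , current input); the stack is empty at the start of a pass.
step : ℕ × List ℕ → ℕ × List ℕ
step (m , I) = pass m I []

iter : ℕ → ℕ × List ℕ → ℕ × List ℕ
iter zero    st = st
iter (suc k) st = step (iter k st)

-- After j returns to the input, the next pass leaves the stack empty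
-- (so the output is complete).
DoneAfter : List ℕ → ℕ → Set
DoneAfter π j = proj₂ (iter (suc j) (1 , π)) ≡ []

RevTier : List ℕ → ℕ → Set
RevTier π t = DoneAfter π t × (∀ j → j < t → ¬ DoneAfter π j)

IsRho : ℕ → ℕ → Set
IsRho n r =
  (∃[ π ] (IsPerm n π × RevTier π r)) ×
  (∀ π → IsPerm n π → ∃[ t ] (RevTier π t × t ≤ r))

data Orientation : Set where
  up down : Orientation

flipO : Orientation → Orientation
flipO up   = down
flipO down = up

UpSeparated : List ℕ → ℕ → Set
UpSeparated σ i = ∃[ a ] ∃[ b ] ∃[ c ] ∃[ k ]
  (σ ≡ a ++ (i ∷ b ++ (suc i ∷ c)) × k ∈ b × suc i < k)

DownSeparated : List ℕ → ℕ → Set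
DownSeparated σ i = ∃[ a ] ∃[ b ] ∃[ c ] ∃[ k ]
  (σ ≡ a ++ (suc i ∷ b ++ (i ∷ c)) × k ∈ b × suc i < k)

SeparatedO : Orientation → List ℕ → ℕ → Set
SeparatedO up   = UpSeparated
SeparatedO down = DownSeparated

AltSep : List ℕ → Orientation → List ℕ → Set
AltSep σ o []       = ⊤
AltSep σ o (i ∷ is) = SeparatedO o σ i × All (i <_) is × AltSep σ (flipO o) is

MaxAltSep : List ℕ → List ℕ → Set
MaxAltSep σ is = AltSep σ down is × (∀ js → AltSep σ down js → length js ≤ length is)

module Submission where

-- If the values still to be output are [m, e), a pass leaves
-- a stack that is a permutation of some [m', e) (pass-spans) whose top is not m'
-- (pass-noPop), so a nonempty one has ≥ 2 values; and m' > m since m was in the input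
-- (pass-progress).  Well-founded induction on e − m gives rev-tier ≤ (e − m) ∸ 2.
--
-- Lower bound.  zigzag m 0 = (m+1, m), zigzag m (t+1) = reverse (zigzag (m+1) t) ++ (m).
-- One pass on zigzag m (t+1) returns exactly zigzag (m+1) t (zigzag-step), so zigzag 1 t
-- has rev-tier t.  Reversal swaps up and down separated pairs (altSep-reverse), so
-- (m,m+1), …, (m+t−1,m+t) alternate in zigzag m t starting down; no alternating sequence
-- is longer, since its smaller entries increase strictly within [m, m+t) (altSep-length).

open import Defs
open import Data.Nat using (ℕ; zero; suc; _+_; _∸_; _≤_; _<_; _≟_; z≤n; s≤s)
open import Data.Nat.Properties
open import Data.Nat.Induction using (<-wellFounded)
open import Induction.WellFounded using (Acc; acc)
open import Data.List using (List; []; _∷_; _++_; [_]; map; upTo; applyUpTo; length; reverse; _ʳ++_)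
open import Data.List.Properties using (++-identityʳ; ++-ʳ++; ʳ++-defn; reverse-++; reverse-involutive; map-upTo)
open import Data.List.Membership.Propositional using (_∈_)
open import Data.List.Membership.Propositional.Properties using (∈-++⁺ˡ; ∈-++⁺ʳ)
open import Data.List.Relation.Unary.Any using (here; there)
open import Data.List.Relation.Unary.All as All using (All; []; _∷_)
open import Data.List.Relation.Unary.AllPairs using (AllPairs; []; _∷_)
open import Data.List.Relation.Binary.Permutation.Propositional using (_↭_; module PermutationReasoning; ↭-sym; ↭-trans; ↭-reflexive; ↭-refl; swap; prep)
open import Data.List.Relation.Binary.Permutation.Propositional.Properties using (¬x∷xs↭[]; drop-∷; shift; ∈-resp-↭; All-resp-↭; ↭-reverse; ∷↭∷ʳ)
open import Data.Product using (_×_; _,_; proj₁; proj₂; ∃-syntax)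
open import Data.Sum using (inj₁; inj₂)
open import Data.Unit using (⊤; tt)
open import Data.Empty using (⊥-elim)
open import Relation.Nullary using (yes; no)
open import Relation.Binary.PropositionalEquality hiding ([_])
open import Function using (_∘_)

interval : ℕ → ℕ → List ℕ
interval m zero    = []
interval m (suc k) = m ∷ interval (suc m) k

∈-interval : ∀ {x} m k → x ∈ interval m k → m ≤ x × x < m + k
∈-interval m (suc k) (here refl) = ≤-refl , m<m+n m (s≤s z≤n)
∈-interval {x} m (suc k) (there x∈) =
  let m<x , x<end = ∈-interval (suc m) k x∈
  in <⇒≤ m<x , subst (x <_) (sym (+-suc m k)) x<end

applyUpTo-interval : ∀ (f : ℕ → ℕ) m k → (∀ i → f i ≡ m + i) → applyUpTo f k ≡ interval m k
applyUpTo-interval f m zero    f≗ = refl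
applyUpTo-interval f m (suc k) f≗ =
  cong₂ _∷_ (trans (f≗ 0) (+-identityʳ m))
            (applyUpTo-interval (λ i → f (suc i)) (suc m) k (λ i → trans (f≗ (suc i)) (+-suc m i)))

upTo-interval : ∀ n → map suc (upTo n) ≡ interval 1 n
upTo-interval n = trans (map-upTo suc n) (applyUpTo-interval suc 1 n (λ _ → refl))

popAll-hit : ∀ m s → popAll m (m ∷ s) ≡ popAll (suc m) s
popAll-hit m s with m ≟ m
... | yes _ = refl
... | no m≢m = ⊥-elim (m≢m refl)

popAll-miss : ∀ m x s → x ≢ m → popAll m (x ∷ s) ≡ (m , x ∷ s)
popAll-miss m x s x≢m with x ≟ m
... | yes x≡m = ⊥-elim (x≢m x≡m)
... | no _ = refl

popAll-above : ∀ m s → All (m <_) s → popAll m s ≡ (m , s)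
popAll-above m []      _          = refl
popAll-above m (x ∷ s) (m<x ∷ _) = popAll-miss m x s (λ x≡m → <-irrefl (sym x≡m) m<x)

NoPop : ℕ → List ℕ → Set
NoPop m []      = ⊤
NoPop m (x ∷ s) = x ≢ m

popAll-noPop : ∀ m s → NoPop (proj₁ (popAll m s)) (proj₂ (popAll m s))
popAll-noPop m []      = tt
popAll-noPop m (x ∷ s) with x ≟ m
... | yes _   = popAll-noPop (suc m) s
... | no x≢m = x≢m

pass-noPop : ∀ m I s → NoPop (proj₁ (pass m I s)) (proj₂ (pass m I s))
pass-noPop m []      s = popAll-noPop m s
pass-noPop m (x ∷ I) s = pass-noPop (proj₁ (popAll m s)) I (x ∷ proj₂ (popAll m s))

popAll-mono : ∀ m s → m ≤ proj₁ (popAll m s)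
popAll-mono m []      = ≤-refl
popAll-mono m (x ∷ s) with x ≟ m
... | yes _ = <⇒≤ (popAll-mono (suc m) s)
... | no _  = ≤-refl

pass-mono : ∀ m I s → m ≤ proj₁ (pass m I s)
pass-mono m []      s = popAll-mono m s
pass-mono m (x ∷ I) s =
  ≤-trans (popAll-mono m s) (pass-mono (proj₁ (popAll m s)) I (x ∷ proj₂ (popAll m s)))

pass-head : ∀ m I s → m < proj₁ (pass m I (m ∷ s))
pass-head m []      s rewrite popAll-hit m s = popAll-mono (suc m) s
pass-head m (x ∷ I) s rewrite popAll-hit m s =
  ≤-trans (popAll-mono (suc m) s) (pass-mono (proj₁ (popAll (suc m) s)) I (x ∷ proj₂ (popAll (suc m) s)))

pass-progress : ∀ m I s → m ∈ I → m < proj₁ (pass m I s)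
pass-progress m (x ∷ I) s m∈ with m≤n⇒m<n∨m≡n (popAll-mono m s)
... | inj₁ m<m' = <-≤-trans m<m' (pass-mono (proj₁ (popAll m s)) I (x ∷ proj₂ (popAll m s)))
... | inj₂ m≡m' = reads (proj₁ (popAll m s)) (proj₂ (popAll m s)) m≡m' m∈
  where
  reads : ∀ m' s' → m ≡ m' → m ∈ x ∷ I → m < proj₁ (pass m' I (x ∷ s'))
  reads .m s' refl (here refl)  = pass-head m I s'
  reads .m s' refl (there m∈I) = pass-progress m I (x ∷ s') m∈I

Spans : ℕ → ℕ × List ℕ → Set
Spans e (m , xs) = ∃[ k ] (xs ↭ interval m k × m + k ≡ e)

-- Popping and pushing only move values between input, stack and output, and the
-- output is always 1, …, m−1; so the unoutput values keep filling an interval [m, e).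
popAll-spans : ∀ e m s I → Spans e (m , s ++ I) →
               Spans e (proj₁ (popAll m s) , proj₂ (popAll m s) ++ I)
popAll-spans e m []      I span = span
popAll-spans e m (x ∷ s) I span with x ≟ m
... | no _ = span
popAll-spans e m (x ∷ s) I (zero  , x∷s↭ , _)    | yes refl = ⊥-elim (¬x∷xs↭[] x∷s↭)
popAll-spans e m (x ∷ s) I (suc k , x∷s↭ , m+k≡e) | yes refl =
  popAll-spans e (suc m) s I (k , drop-∷ x∷s↭ , trans (sym (+-suc m k)) m+k≡e)

pass-spans : ∀ e m I s → Spans e (m , s ++ I) → Spans e (pass m I s)
pass-spans e m []      s span with popAll-spans e m s [] span
... | k , s'↭ , eq = k , ↭-trans (↭-sym (↭-reflexive (++-identityʳ _))) s'↭ , eq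
pass-spans e m (x ∷ I) s span with popAll-spans e m s (x ∷ I) span
... | k , s'xI↭ , eq = pass-spans e (proj₁ (popAll m s)) I (x ∷ proj₂ (popAll m s))
                         (k , ↭-trans (↭-sym (shift x (proj₂ (popAll m s)) I)) s'xI↭ , eq)

TierFrom : ℕ × List ℕ → ℕ → Set
TierFrom st t = proj₂ (iter (suc t) st) ≡ [] × (∀ j → j < t → proj₂ (iter (suc j) st) ≢ [])

iter-step : ∀ j st → iter j (step st) ≡ iter (suc j) st
iter-step zero    st = refl
iter-step (suc j) st = cong step (iter-step j st)

tier-finish : ∀ st → proj₂ (step st) ≡ [] → TierFrom st 0
tier-finish st done = done , λ _ ()

tier-return : ∀ st t → proj₂ (step st) ≢ [] → TierFrom (step st) t → TierFrom st (suc t)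
tier-return st t notDone (done , notBefore) = subst (λ z → proj₂ z ≡ []) (iter-step (suc t) st) done , early
  where
  early : ∀ j → j < suc t → proj₂ (iter (suc j) st) ≢ []
  early zero    _         = notDone
  early (suc j) (s≤s j<t) = notBefore j j<t ∘ subst (λ z → proj₂ z ≡ []) (sym (iter-step (suc j) st))

-- A stuck nonempty stack spanning an interval holds at least two values: a single
-- value m' would be on top and could be popped.
stuck-size : ∀ m' x s k → x ∷ s ↭ interval m' k → x ≢ m' → 2 ≤ k
stuck-size m' x s zero          x∷s↭ _ = ⊥-elim (¬x∷xs↭[] x∷s↭)
stuck-size m' x s (suc zero)    x∷s↭ x≢m' with ∈-resp-↭ x∷s↭ (here refl)
... | here x≡m' = ⊥-elim (x≢m' x≡m')
... | there ()
stuck-size m' x s (suc (suc k)) _    _ = s≤s (s≤s z≤n)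

-- Upper bound: a permutation of an interval of k values has rev-tier at most k ∸ 2.
-- One pass leaves a stuck stack spanning [m', m+k) with m < m' (so fewer values) and,
-- if nonempty, at least two values; recurse on its size.
tier-bound : ∀ k → Acc _<_ k → ∀ m I → I ↭ interval m k → ∃[ t ] (TierFrom (m , I) t × t ≤ k ∸ 2)
tier-bound k (acc smaller) m I I↭
  with pass m I [] in passEq | pass-spans (m + k) m I [] (k , I↭ , refl) | pass-noPop m I [] | pass-mono m I []
... | m' , []    | _                        | _    | _    = 0 , tier-finish (m , I) (cong proj₂ passEq) , z≤n
... | m' , x ∷ s | k' , stack↭ , m'+k'≡m+k | x≢m' | m≤m' =
  suc t , tier-return (m , I) t notDone (subst (λ st → TierFrom st t) (sym passEq) tier) , bound
  where
  2≤k' : 2 ≤ k'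
  2≤k' = stuck-size m' x s k' stack↭ x≢m'
  k'≤k : k' ≤ k
  k'≤k = +-cancelˡ-≤ m k' k (≤-trans (+-monoˡ-≤ k' m≤m') (≤-reflexive m'+k'≡m+k))
  -- k ≥ 2, so m is one of the values to be read
  m∈I : m ∈ I
  m∈I with ≤-trans 2≤k' k'≤k
  ... | s≤s _ = ∈-resp-↭ (↭-sym I↭) (here refl)
  m<m' : m < m'
  m<m' = subst (λ st → m < proj₁ st) passEq (pass-progress m I [] m∈I)
  k'<k : k' < k
  k'<k = +-cancelˡ-< m k' k (<-≤-trans (+-monoˡ-< k' m<m') (≤-reflexive m'+k'≡m+k))
  notDone : proj₂ (step (m , I)) ≢ []
  notDone done with trans (sym (cong proj₂ passEq)) done
  ... | ()
  recursive : ∃[ t ] (TierFrom (m' , x ∷ s) t × t ≤ k' ∸ 2)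
  recursive = tier-bound k' (smaller k'<k) m' (x ∷ s) stack↭
  t : ℕ
  t = proj₁ recursive
  tier : TierFrom (m' , x ∷ s) t
  tier = proj₁ (proj₂ recursive)
  bound : suc t ≤ k ∸ 2
  bound = ≤-trans (s≤s (proj₂ (proj₂ recursive))) (∸-monoˡ-< k'<k 2≤k')

zigzag : ℕ → ℕ → List ℕ
zigzag m zero    = suc m ∷ m ∷ []
zigzag m (suc t) = reverse (zigzag (suc m) t) ++ [ m ]

zigzag-perm : ∀ m t → zigzag m t ↭ interval m (2 + t)
zigzag-perm m zero    = swap (suc m) m ↭-refl
zigzag-perm m (suc t) = begin
  reverse (zigzag (suc m) t) ++ [ m ] ↭⟨ ↭-sym (∷↭∷ʳ m (reverse (zigzag (suc m) t))) ⟩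
  m ∷ reverse (zigzag (suc m) t)      ↭⟨ prep m (↭-reverse (zigzag (suc m) t)) ⟩
  m ∷ zigzag (suc m) t                ↭⟨ prep m (zigzag-perm (suc m) t) ⟩
  interval m (3 + t)                  ∎
  where open PermutationReasoning

reverse-ends : ∀ (x : ℕ) mid y → reverse (x ∷ mid ++ [ y ]) ≡ y ∷ reverse mid ++ [ x ]
reverse-ends x mid y = begin
  reverse ((x ∷ mid) ++ [ y ])  ≡⟨ reverse-++ (x ∷ mid) [ y ] ⟩
  y ∷ reverse (x ∷ mid)         ≡⟨ cong (y ∷_) (reverse-++ [ x ] mid) ⟩
  y ∷ reverse mid ++ [ x ]      ∎
  where open ≡-Reasoning

zigzag-shape : ∀ m t → ∃[ mid ] (zigzag m t ≡ suc m ∷ mid ++ [ m ])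
zigzag-shape m zero    = [] , refl
zigzag-shape m (suc t) with zigzag-shape (suc m) t
... | mid , eq = reverse mid ++ [ suc (suc m) ] ,
                 cong (_++ [ m ]) (trans (cong reverse eq) (reverse-ends (suc (suc m)) mid (suc m)))

zigzag-above : ∀ m t → All (m <_) (zigzag (suc m) t)
zigzag-above m t = All.tabulate (λ x∈ → proj₁ (∈-interval (suc m) (2 + t) (∈-resp-↭ (zigzag-perm (suc m) t) x∈)))

pass-push : ∀ m xs J s → All (m <_) xs → All (m <_) s → pass m (xs ++ J) s ≡ pass m J (xs ʳ++ s)
pass-push m []       J s _           _      = refl
pass-push m (x ∷ xs) J s (m<x ∷ xs>m) s>m rewrite popAll-above m s s>m =
  pass-push m xs J (x ∷ s) xs>m (m<x ∷ s>m)

-- The top of zigzag m t is m+1, so nothing pops while m is awaited.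
zigzag-stuck : ∀ m t → popAll m (zigzag m t) ≡ (m , zigzag m t)
zigzag-stuck m t with zigzag-shape m t
... | mid , eq rewrite eq = popAll-miss m (suc m) (mid ++ [ m ]) 1+n≢n

-- A pass on  reverse τ ++ [ m ]  with all of τ above m pushes τ back into its original
-- order, then outputs m and continues popping from τ.
pass-reverse-then-min : ∀ m τ → All (m <_) τ → step (m , reverse τ ++ [ m ]) ≡ popAll (suc m) τ
pass-reverse-then-min m τ τ>m = begin
  pass m (reverse τ ++ [ m ]) []  ≡⟨ pass-push m (reverse τ) [ m ] [] reverse-above [] ⟩
  pass m [ m ] (reverse τ ʳ++ []) ≡⟨ cong (pass m [ m ]) reverse-twice ⟩
  pass m [ m ] τ                  ≡⟨ cong (λ st → popAll (proj₁ st) (m ∷ proj₂ st)) (popAll-above m τ τ>m) ⟩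
  popAll m (m ∷ τ)                ≡⟨ popAll-hit m τ ⟩
  popAll (suc m) τ                ∎
  where
  open ≡-Reasoning
  reverse-above : All (m <_) (reverse τ)
  reverse-above = All-resp-↭ (↭-sym (↭-reverse τ)) τ>m
  reverse-twice : reverse τ ʳ++ [] ≡ τ
  reverse-twice = trans (ʳ++-defn (reverse τ)) (trans (++-identityʳ _) (reverse-involutive τ))

zigzag-step : ∀ m t → step (m , zigzag m (suc t)) ≡ (suc m , zigzag (suc m) t)
zigzag-step m t = trans (pass-reverse-then-min m (zigzag (suc m) t) (zigzag-above m t)) (zigzag-stuck (suc m) t)

zigzag-tier : ∀ t m → TierFrom (m , zigzag m t) t
zigzag-tier zero    m = tier-finish (m , zigzag m 0) (cong proj₂ finish)
  where
  finish : step (m , zigzag m 0) ≡ (suc (suc m) , [])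
  finish = trans (pass-reverse-then-min m [ suc m ] (≤-refl ∷ [])) (popAll-hit (suc m) [])
zigzag-tier (suc t) m =
  tier-return (m , zigzag m (suc t)) t notDone
    (subst (λ st → TierFrom st t) (sym (zigzag-step m t)) (zigzag-tier t (suc m)))
  where
  notDone : proj₂ (step (m , zigzag m (suc t))) ≢ []
  notDone done with zigzag-shape (suc m) t | trans (sym (cong proj₂ (zigzag-step m t))) done
  ... | mid , eq | returned≡[] with trans (sym eq) returned≡[]
  ... | ()

reverse-split : ∀ (a : List ℕ) i b j c z →
  reverse (a ++ (i ∷ b ++ (j ∷ c))) ++ z ≡ reverse c ++ (j ∷ reverse b ++ (i ∷ reverse a ++ z))
reverse-split a i b j c z = begin
  reverse (a ++ (i ∷ b ++ (j ∷ c))) ++ z                ≡⟨ sym (ʳ++-defn (a ++ (i ∷ b ++ (j ∷ c)))) ⟩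
  (a ++ (i ∷ b ++ (j ∷ c))) ʳ++ z                       ≡⟨ ++-ʳ++ a ⟩
  (b ++ (j ∷ c)) ʳ++ (i ∷ a ʳ++ z)                      ≡⟨ ++-ʳ++ b ⟩
  c ʳ++ (j ∷ b ʳ++ (i ∷ a ʳ++ z))                       ≡⟨ ʳ++-defn c ⟩
  reverse c ++ (j ∷ b ʳ++ (i ∷ a ʳ++ z))                ≡⟨ cong (λ w → reverse c ++ (j ∷ w)) (ʳ++-defn b) ⟩
  reverse c ++ (j ∷ reverse b ++ (i ∷ a ʳ++ z))         ≡⟨ cong (λ w → reverse c ++ (j ∷ reverse b ++ (i ∷ w))) (ʳ++-defn a) ⟩
  reverse c ++ (j ∷ reverse b ++ (i ∷ reverse a ++ z))  ∎
  where open ≡-Reasoning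

separated-reverse : ∀ o σ i z → SeparatedO o σ i → SeparatedO (flipO o) (reverse σ ++ z) i
separated-reverse up σ i z (a , b , c , k , refl , k∈b , i+1<k) =
  reverse c , reverse b , reverse a ++ z , k ,
  reverse-split a i b (suc i) c z , ∈-resp-↭ (↭-sym (↭-reverse b)) k∈b , i+1<k
separated-reverse down σ i z (a , b , c , k , refl , k∈b , i+1<k) =
  reverse c , reverse b , reverse a ++ z , k ,
  reverse-split a (suc i) b i c z , ∈-resp-↭ (↭-sym (↭-reverse b)) k∈b , i+1<k

altSep-reverse : ∀ σ o is z → AltSep σ o is → AltSep (reverse σ ++ z) (flipO o) is
altSep-reverse σ o []       z _                      = tt
altSep-reverse σ o (i ∷ is) z (sep , is>i , rest) =
  separated-reverse o σ i z sep , is>i , altSep-reverse σ (flipO o) is z rest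

zigzag-down : ∀ m t → DownSeparated (zigzag m (suc t)) m
zigzag-down m t with zigzag-shape (suc m) t
... | mid , eq = [] , between , [] , suc (suc m) , split , m+2∈ , ≤-refl
  where
  between : List ℕ
  between = reverse mid ++ [ suc (suc m) ]
  split : zigzag m (suc t) ≡ suc m ∷ between ++ [ m ]
  split = cong (_++ [ m ]) (trans (cong reverse eq) (reverse-ends (suc (suc m)) mid (suc m)))
  m+2∈ : suc (suc m) ∈ between
  m+2∈ = ∈-++⁺ʳ (reverse mid) (here refl)

zigzag-alternates : ∀ t m → AltSep (zigzag m t) down (interval m t)
zigzag-alternates zero    m = tt
zigzag-alternates (suc t) m =
  zigzag-down m t ,
  All.tabulate (λ i∈ → proj₁ (∈-interval (suc m) t i∈)) ,
  altSep-reverse (zigzag (suc m) t) down (interval (suc m) t) [ m ] (zigzag-alternates t (suc m))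

separated-members : ∀ o σ i → SeparatedO o σ i → i ∈ σ × ∃[ k ] (k ∈ σ × suc i < k)
separated-members up σ i (a , b , c , k , refl , k∈b , i+1<k) =
  ∈-++⁺ʳ a (here refl) , k , ∈-++⁺ʳ a (there (∈-++⁺ˡ k∈b)) , i+1<k
separated-members down σ i (a , b , c , k , refl , k∈b , i+1<k) =
  ∈-++⁺ʳ a (there (∈-++⁺ʳ b (here refl))) , k , ∈-++⁺ʳ a (there (∈-++⁺ˡ k∈b)) , i+1<k

separated-window : ∀ o σ m w i → σ ↭ interval m (2 + w) → SeparatedO o σ i → m ≤ i × i < m + w
separated-window o σ m w i σ↭ sep with separated-members o σ i sep
... | i∈σ , k , k∈σ , i+1<k = proj₁ (∈-interval m (2 + w) (∈-resp-↭ σ↭ i∈σ)) , i<m+w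
  where
  k<end : k < suc (suc (m + w))
  k<end = subst (k <_) (trans (+-suc m (suc w)) (cong suc (+-suc m w)))
                (proj₂ (∈-interval m (2 + w) (∈-resp-↭ σ↭ k∈σ)))
  i<m+w : i < m + w
  i<m+w = ≤-pred (≤-pred (≤-trans (s≤s i+1<k) k<end))

altSep-all : ∀ {P : ℕ → Set} σ → (∀ o i → SeparatedO o σ i → P i) → ∀ o is → AltSep σ o is → All P is
altSep-all σ sep⇒P o []       _                  = []
altSep-all σ sep⇒P o (i ∷ is) (sep , _ , rest) = sep⇒P o i sep ∷ altSep-all σ sep⇒P (flipO o) is rest

altSep-increasing : ∀ σ o is → AltSep σ o is → AllPairs _<_ is
altSep-increasing σ o []       _                     = []
altSep-increasing σ o (i ∷ is) (_ , is>i , rest) = is>i ∷ altSep-increasing σ (flipO o) is rest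

increasing-length : ∀ w lo js → AllPairs _<_ js → All (λ i → lo ≤ i × i < lo + w) js → length js ≤ w
increasing-length w       lo []       _              _                         = z≤n
increasing-length zero    lo (i ∷ js) _              ((lo≤i , i<lo+0) ∷ _) =
  ⊥-elim (<⇒≱ (subst (i <_) (+-identityʳ lo) i<lo+0) lo≤i)
increasing-length (suc w) lo (i ∷ js) (js>i ∷ inc) ((lo≤i , _) ∷ inWindow) =
  s≤s (increasing-length w (suc lo) js inc (All.zipWith narrow (js>i , inWindow)))
  where
  narrow : ∀ {x : ℕ} → i < x × (lo ≤ x × x < lo + suc w) → suc lo ≤ x × x < suc lo + w
  narrow {x} (i<x , _ , x<end) = ≤-trans (s≤s lo≤i) i<x , subst (λ end → x < end) (+-suc lo w) x<end

length-interval : ∀ m k → length (interval m k) ≡ k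
length-interval m zero    = refl
length-interval m (suc k) = cong suc (length-interval (suc m) k)

altSep-length : ∀ σ m w o js → σ ↭ interval m (2 + w) → AltSep σ o js → length js ≤ w
altSep-length σ m w o js σ↭ alt =
  increasing-length w m js (altSep-increasing σ o js alt)
    (altSep-all σ (λ o' i → separated-window o' σ m w i σ↭) o js alt)

zigzag-maxAltSep : ∀ t m → MaxAltSep (zigzag m t) (interval m t)
zigzag-maxAltSep t m = zigzag-alternates t m , longest
  where
  longest : ∀ js → AltSep (zigzag m t) down js → length js ≤ length (interval m t)
  longest js alt = subst (length js ≤_) (sym (length-interval m t))
    (altSep-length (zigzag m t) m t down js (zigzag-perm m t) alt)

mainTheorem7 : (n : ℕ) → 2 ≤ n →
    IsRho n (n ∸ 2) ×
    ∃[ π ] (IsPerm n π × RevTier π (n ∸ 2) × MaxAltSep π (map suc (upTo (n ∸ 2))))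
mainTheorem7 .(suc (suc t)) (s≤s (s≤s {n = t} _)) =
  ((zigzag 1 t , zigzag-isPerm , zigzag-tier t 1) , atMost) ,
  zigzag 1 t , zigzag-isPerm , zigzag-tier t 1 ,
  subst (MaxAltSep (zigzag 1 t)) (sym (upTo-interval t)) (zigzag-maxAltSep t 1)
  where
  zigzag-isPerm : IsPerm (2 + t) (zigzag 1 t)
  zigzag-isPerm = ↭-trans (zigzag-perm 1 t) (↭-reflexive (sym (upTo-interval (2 + t))))
  atMost : ∀ π → IsPerm (2 + t) π → ∃[ r ] (RevTier π r × r ≤ t)
  atMost π π↭ = tier-bound (2 + t) (<-wellFounded (2 + t)) 1 π (↭-trans π↭ (↭-reflexive (upTo-interval (2 + t))))
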